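{- Let $C_1,\dots,C_r$ be nontrivial finite cyclic groups. Then $\mathrm{wl}(C_1\wr(C_2\wr(\cdots\wr C_r)\cdots))=r$.
   Context: For groups $H,G$, the standard wreath product $H\wr G$ is the set of pairs $(f,g)$, $f:G\to H$ a function, $g\in G$, with multiplication $(f_1,g_1)(f_2,g_2)=(f_1f_2^{g_1^{ -1}},g_1g_2)$, where $f^{g^{ -1}}(x)=f(xg)$. A finite group is semiabelian if it belongs to the smallest family $\mathcal{SA}$ of finite groups such that: (i) every finite abelian group is in $\mathcal{SA}$; (ii) if $G\in\mathcal{SA}$ and $A$ is finite abelian then every semidirect product $A\rtimes G$ is in $\mathcal{SA}$; (iii) every homomorphic image of a group in $\mathcal{SA}$ is in $\mathcal{SA}$. The wreath length $\mathrm{wl}(G)$ of a finite semiabelian group $G$ is the smallest positive integer $s$ such that there exist finite cyclic groups $C'_1,\dots,C'_s$ and an epimorphism $C'_1\wr(C'_2\wr(\cdots\wr C'_s)\cdots)\to G$. -}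

module Defs where

open import Level using (0ℓ)
open import Data.Nat as ℕ using (ℕ; zero; suc; _≤_; _<_)
open import Data.Integer as ℤ using (ℤ; +_; _+_; _-_; -_; _*_)
open import Data.Integer.Divisibility.Signed using (_∣_; divides; ∣m⇒∣-m; ∣m∣n⇒∣m+n)
open import Data.Integer.Tactic.RingSolver using (solve-∀)
open import Data.Integer.Properties as ℤP using ()
open import Data.Product using (Σ; ∃; _×_; _,_; proj₁; proj₂)
open import Data.Vec using (Vec; []; _∷_)
open import Data.Vec.Relation.Unary.All using (All)
open import Relation.Nullary using (¬_)
open import Data.Empty using (⊥)
open import Relation.Binary.PropositionalEquality as ≡ using (_≡_; subst)
open import Algebra.Bundles using (Group)
open import Algebra.Structures using (IsGroup)
open import Algebra.Morphism.Structures using (module GroupMorphisms)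
open import Function.Definitions using (Surjective)
import Relation.Binary.Reasoning.Setoid as SetoidReasoning

-- The finite cyclic group ℤ/nℤ (n ≥ 1 gives a finite cyclic group of
-- order n): carrier ℤ, equality "congruent modulo n", operation +.

module _ (n : ℕ) where

  _≈ₙ_ : ℤ → ℤ → Set
  x ≈ₙ y = (+ n) ∣ (x - y)

  private
    ≡-diff : ∀ {d d'} → d ≡ d' → (+ n) ∣ d' → (+ n) ∣ d
    ≡-diff e p = subst ((+ n) ∣_) (≡.sym e) p

    ∣0 : (+ n) ∣ (+ 0)
    ∣0 = divides (+ 0) (≡.sym (ℤP.*-zeroˡ (+ n)))

    reflexive : ∀ {x y} → x ≡ y → x ≈ₙ y
    reflexive {x} ≡.refl = ≡-diff (ℤP.+-inverseʳ x) ∣0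

  ℤmod-isGroup : IsGroup _≈ₙ_ _+_ (+ 0) (λ x → - x)
  ℤmod-isGroup = record
    { isMonoid = record
      { isSemigroup = record
        { isMagma = record
          { isEquivalence = record
            { refl = λ {x} → reflexive {x} ≡.refl
            ; sym = λ {x} {y} p → ≡-diff (lem-sym x y) (∣m⇒∣-m p)
            ; trans = λ {x} {y} {z} p q → ≡-diff (lem-trans x y z) (∣m∣n⇒∣m+n p q)
            }
          ; ∙-cong = λ {x} {x'} {y} {y'} p q → ≡-diff (lem-cong x x' y y') (∣m∣n⇒∣m+n p q)
          }
        ; assoc = λ x y z → reflexive (ℤP.+-assoc x y z)
        }
      ; identity = (λ x → reflexive (ℤP.+-identityˡ x)) , (λ x → reflexive (ℤP.+-identityʳ x))
      }
    ; inverse = (λ x → reflexive (ℤP.+-inverseˡ x)) , (λ x → reflexive (ℤP.+-inverseʳ x))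
    ; ⁻¹-cong = λ {x} {y} p → ≡-diff (lem-neg x y) (∣m⇒∣-m p)
    }
    where
    lem-sym : ∀ (x y : ℤ) → y - x ≡ - (x - y)
    lem-sym = solve-∀
    lem-trans : ∀ (x y z : ℤ) → x - z ≡ (x - y) + (y - z)
    lem-trans = solve-∀
    lem-cong : ∀ (x x' y y' : ℤ) → (x + y) - (x' + y') ≡ (x - x') + (y - y')
    lem-cong = solve-∀
    lem-neg : ∀ (x y : ℤ) → (- x) + (- (- y)) ≡ - (x + (- y))
    lem-neg = solve-∀

  Cyclic : Group 0ℓ 0ℓ
  Cyclic = record { isGroup = ℤmod-isGroup }

-- The standard (unrestricted) wreath product H ≀ G: pairs (f , g) with
-- f : G → H a function (respecting the equality of G) and g ∈ G, with
-- (f₁ , g₁)(f₂ , g₂) = (f₁ f₂^{g₁⁻¹} , g₁ g₂), where f^{g⁻¹}(x) = f(x g).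

module Wreath (H G : Group 0ℓ 0ℓ) where
  private
    module H = Group H
    module G = Group G

  record Elt : Set where
    constructor mk
    field
      fn   : G.Carrier → H.Carrier
      cong : ∀ {x y} → x G.≈ y → fn x H.≈ fn y
      pos  : G.Carrier
  open Elt

  _≈_ : Elt → Elt → Set
  a ≈ b = (∀ x → fn a x H.≈ fn b x) × (pos a G.≈ pos b)

  _∙_ : Elt → Elt → Elt
  a ∙ b = mk (λ x → fn a x H.∙ fn b (x G.∙ pos a))
             (λ p → H.∙-cong (cong a p) (cong b (G.∙-congʳ p)))
             (pos a G.∙ pos b)

  ε : Elt
  ε = mk (λ _ → H.ε) (λ _ → H.refl) G.ε

  _⁻¹ : Elt → Elt
  a ⁻¹ = mk (λ x → fn a (x G.∙ pos a G.⁻¹) H.⁻¹)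
            (λ p → H.⁻¹-cong (cong a (G.∙-congʳ p)))
            (pos a G.⁻¹)

  isGroup : IsGroup _≈_ _∙_ ε _⁻¹
  isGroup = record
    { isMonoid = record
      { isSemigroup = record
        { isMagma = record
          { isEquivalence = record
            { refl = (λ x → H.refl) , G.refl
            ; sym = λ (p , q) → (λ x → H.sym (p x)) , G.sym q
            ; trans = λ (p , q) (p' , q') → (λ x → H.trans (p x) (p' x)) , G.trans q q'
            }
          ; ∙-cong = λ {a} {a'} {b} {b'} (p , q) (p' , q') →
              (λ x → H.∙-cong (p x) (H.trans (cong b (G.∙-congˡ q)) (p' (x G.∙ pos a'))))
              , G.∙-cong q q'
          }
        ; assoc = λ a b c →
            (λ x → H.trans (H.assoc _ _ _)
                     (H.∙-congˡ (H.∙-congˡ (cong c (G.sym (G.assoc x (pos a) (pos b)))))))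
            , G.assoc _ _ _
        }
      ; identity = (λ a → (λ x → H.trans (H.identityˡ _) (cong a (G.identityʳ x))) , G.identityˡ _)
                 , (λ a → (λ x → H.identityʳ _) , G.identityʳ _)
      }
    ; inverse = (λ a → (λ x → H.inverseˡ _) , G.inverseˡ _)
              , (λ a → (λ x → H.trans (H.∙-congˡ (H.⁻¹-cong (cong a (inv-lem x (pos a)))))
                                        (H.inverseʳ _))
                       , G.inverseʳ _)
    ; ⁻¹-cong = λ {a} {b} (p , q) →
        (λ x → H.⁻¹-cong (H.trans (cong a (G.∙-congˡ (G.⁻¹-cong q))) (p _)))
        , G.⁻¹-cong q
    }
    where
    inv-lem : ∀ x g → (x G.∙ g) G.∙ g G.⁻¹ G.≈ x
    inv-lem x g = G.trans (G.assoc _ _ _)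
                   (G.trans (G.∙-congˡ (G.inverseʳ g)) (G.identityʳ x))

  group : Group 0ℓ 0ℓ
  group = record { isGroup = isGroup }

_≀_ : Group 0ℓ 0ℓ → Group 0ℓ 0ℓ → Group 0ℓ 0ℓ
H ≀ G = Wreath.group H G

IterWreath : ∀ {k} → Vec ℕ (suc k) → Group 0ℓ 0ℓ
IterWreath (n ∷ [])         = Cyclic n
IterWreath (n ∷ ns@(_ ∷ _)) = Cyclic n ≀ IterWreath ns

Epimorphism : Group 0ℓ 0ℓ → Group 0ℓ 0ℓ → Set
Epimorphism A B =
  Σ (Group.Carrier A → Group.Carrier B) λ f →
    GroupMorphisms.IsGroupHomomorphism (Group.rawGroup A) (Group.rawGroup B) f
    × Surjective (Group._≈_ A) (Group._≈_ B) f

-- G is an epimorphic image of C'₁ ≀ ( ⋯ ≀ C'_{suc k}) for some finite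
-- cyclic groups C'ᵢ (orders ≥ 1; the trivial group is allowed).
ImageOfCyclicWreath : ℕ → Group 0ℓ 0ℓ → Set
ImageOfCyclicWreath k G =
  ∃ λ (ms : Vec ℕ (suc k)) → All (1 ≤_) ms × Epimorphism (IterWreath ms) G

-- "wl(G) = s": s is the smallest positive integer such that G is an
-- epimorphic image of an s-fold iterated wreath product of finite
-- cyclic groups.
WreathLengthIs : Group 0ℓ 0ℓ → ℕ → Set
WreathLengthIs G zero    = ⊥
WreathLengthIs G (suc k) =
  ImageOfCyclicWreath k G × (∀ j → j < k → ¬ ImageOfCyclicWreath j G)

module Submission where

-- Both directions are about iterated commutators: say a
-- group satisfies the depth-m law if every m-fold iterated commutator
-- (bracketing given by a complete binary tree of depth m) is trivial.
--
-- wl ≤ r is witnessed by the identity epimorphism.  For wl ≥ r: abelian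
-- groups satisfy the depth-1 law, H ≀ G satisfies depth m+1 when H is
-- abelian and G satisfies depth m, and laws pass to epimorphic images and
-- to larger depths; so it suffices to find a nontrivial (r-1)-fold
-- commutator in our group.  It is built inductively: a tree t in G is
-- lifted into the top group of H ≀ G and its rightmost leaf is given a
-- function f : G → H; the base coordinate of the resulting commutator is
-- an alternating sum of f over the "spine points" of t.  Taking f to be the
-- indicator of one spine point makes this sum nontrivial.  Constructively,
-- that indicator is provided by a *selector* (an invariant Boolean test
-- singling out one spine point), which is exactly what propagates from t
-- to the new tree.

open import Defs
open import Data.Nat using (ℕ; suc; _≤_)
open import Data.Vec using (Vec)
open import Data.Vec.Relation.Unary.All using (All)

open import Level using (0ℓ)
open import Data.Nat using (zero; _<_; _≤′_; ≤′-refl; ≤′-step; s≤s)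
open import Data.Nat.Properties using (≤⇒≤′; ≤-trans; n≤1+n)
import Data.Nat.Divisibility as ℕ∣
open import Data.Integer using (+_; _-_)
import Data.Integer.Properties as ℤ
open import Data.Integer.Divisibility.Signed using (_∣?_; ∣⇒∣ᵤ)
open import Data.Bool using (Bool; true; false; if_then_else_; _∧_)
import Data.Bool as Bool
import Data.Bool.Properties as Bool
open import Data.Vec using ([]; _∷_; replicate)
import Data.Vec.Properties as Vec
import Data.Vec.Relation.Unary.All as All
open import Data.Product using (Σ; _,_; proj₁; proj₂)
open import Data.Empty using (⊥-elim)
open import Relation.Nullary using (¬_; yes; no; does; contradiction)
open import Relation.Nullary.Decidable using (dec-true; dec-false; does-⇔)
open import Relation.Binary.Definitions using (Decidable)
open import Relation.Binary.PropositionalEquality as ≡ using (_≡_; _≢_; refl)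
open import Function.Bundles using (mk⇔)
open import Algebra.Bundles using (Group)
open import Algebra.Morphism.Structures using (module GroupMorphisms)
import Algebra.Morphism.Construct.Identity as Identity
import Algebra.Properties.Group as GroupProperties
import Relation.Binary.Reasoning.Setoid as SetoidReasoning

data Tree (X : Set) : ℕ → Set where
  leaf : X → Tree X zero
  node : ∀ {m} → Tree X m → Tree X m → Tree X (suc m)

mapTree : ∀ {X Y : Set} {m} → (X → Y) → Tree X m → Tree Y m
mapTree f (leaf x)   = leaf (f x)
mapTree f (node l r) = node (mapTree f l) (mapTree f r)

corner : ∀ d → Vec Bool d
corner d = replicate d true

does-resp : (K : Group 0ℓ 0ℓ) (_≟_ : Decidable (Group._≈_ K)) →
  ∀ {a b c} → Group._≈_ K a b → does (a ≟ c) ≡ does (b ≟ c)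
does-resp K _≟_ {a} {b} {c} a≈b =
  does-⇔ (mk⇔ (trans (sym a≈b)) (trans a≈b)) (a ≟ c) (b ≟ c)
  where open Group K

module Commutators (K : Group 0ℓ 0ℓ) where
  open Group K

  -- The commutator, in the convention [ x , y ] = (x y)(y x)⁻¹.
  [_,_] : Carrier → Carrier → Carrier
  [ x , y ] = (x ∙ y) ∙ (y ∙ x) ⁻¹

  δ : ∀ {m} → Tree Carrier m → Carrier
  δ (leaf x)   = x
  δ (node l r) = [ δ l , δ r ]

  comm-cong : ∀ {x x' y y'} → x ≈ x' → y ≈ y' → [ x , y ] ≈ [ x' , y' ]
  comm-cong x≈x' y≈y' = ∙-cong (∙-cong x≈x' y≈y') (⁻¹-cong (∙-cong y≈y' x≈x'))

  comm-self : ∀ x → [ x , x ] ≈ ε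
  comm-self x = inverseʳ (x ∙ x)

  -- K satisfies the depth-m law: every depth-m iterated commutator is
  -- trivial (equivalently, K has derived length at most m).
  Law : ℕ → Set
  Law m = ∀ (t : Tree Carrier m) → δ t ≈ ε

  law-suc : ∀ {m} → Law m → Law (suc m)
  law-suc law (node l r) = trans (comm-cong (law l) (law r)) (comm-self ε)

  law-mono : ∀ {m k} → m ≤′ k → Law m → Law k
  law-mono ≤′-refl     law = law
  law-mono (≤′-step p) law = law-suc (law-mono p law)

  abelian⇒law₁ : (∀ x y → x ∙ y ≈ y ∙ x) → Law 1
  abelian⇒law₁ comm (node (leaf x) (leaf y)) =
    trans (∙-congˡ (⁻¹-cong (comm y x))) (inverseʳ (x ∙ y))

  -- The spine points of t: the points at which the function attached to
  -- the rightmost leaf gets sampled when t is perturbed inside a wreath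
  -- product (see Perturbation below).
  spine : ∀ {m} → Tree Carrier m → Vec Bool m → Carrier
  spine (leaf x)   []          = ε
  spine (node l r) (true ∷ S)  = δ l ∙ spine r S
  spine (node l r) (false ∷ S) = δ (node l r) ∙ spine r S

  record Selector {m} (t : Tree Carrier m) : Set where
    field
      select        : Carrier → Bool
      select-cong   : ∀ {x y} → x ≈ y → select x ≡ select y
      select-corner : select (spine (node t t) (corner (suc m))) ≡ true
      select-other  : ∀ S → S ≢ corner (suc m) → select (spine (node t t) S) ≡ false

  -- A tree with a selector has a nontrivial commutator: if δ t were
  -- trivial, the two spine points (true ∷ corner) and (false ∷ corner)
  -- of node t t would coincide.
  selector⇒nontrivial : ∀ {m} {t : Tree Carrier m} → Selector t → ¬ δ t ≈ ε
  selector⇒nontrivial {m} {t} sel δt≈ε = contradiction true≡false λ ()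
    where
    open Selector sel
    coincide : δ t ∙ spine t (corner m) ≈ [ δ t , δ t ] ∙ spine t (corner m)
    coincide = ∙-congʳ (trans δt≈ε (sym (comm-self (δ t))))
    true≡false : true ≡ false
    true≡false = ≡.trans (≡.sym select-corner)
      (≡.trans (select-cong coincide) (select-other (false ∷ corner m) λ ()))

  leaf-selector : Decidable _≈_ → ∀ {h} → ¬ h ≈ ε → Selector (leaf h)
  leaf-selector _≟_ {h} h≉ε = record
    { select        = λ x → does (x ≟ h)
    ; select-cong   = does-resp K _≟_
    ; select-corner = dec-true ((h ∙ ε) ≟ h) (identityʳ h)
    ; select-other  = other
    }
    where
    other : ∀ S → S ≢ corner 1 → does (spine (node (leaf h) (leaf h)) S ≟ h) ≡ false
    other (true ∷ [])  S≢corner = ⊥-elim (S≢corner ≡.refl)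
    other (false ∷ []) _        = dec-false (([ h , h ] ∙ ε) ≟ h)
      λ e → h≉ε (trans (sym e) (trans (identityʳ _) (comm-self h)))

law-image : ∀ {A B : Group 0ℓ 0ℓ} → Epimorphism A B →
  ∀ {m} → Commutators.Law A m → Commutators.Law B m
law-image {A} {B} (φ , hom , surj) law t =
  B.trans (δ≈φδpre t) (B.trans (⟦⟧-cong (law (pre t))) ε-homo)
  where
  module A = Group A
  module B = Group B
  module CA = Commutators A
  module CB = Commutators B
  open GroupMorphisms.IsGroupHomomorphism hom

  comm-homo : ∀ x y → φ CA.[ x , y ] B.≈ CB.[ φ x , φ y ]
  comm-homo x y = B.trans (homo _ _)
    (B.∙-cong (homo x y) (B.trans (⁻¹-homo _) (B.⁻¹-cong (homo y x))))

  pre : ∀ {m} → Tree B.Carrier m → Tree A.Carrier m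
  pre (leaf y)   = leaf (proj₁ (surj y))
  pre (node l r) = node (pre l) (pre r)

  δ≈φδpre : ∀ {m} (t : Tree B.Carrier m) → CB.δ t B.≈ φ (CA.δ (pre t))
  δ≈φδpre (leaf y)   = B.sym (proj₂ (surj y) A.refl)
  δ≈φδpre (node l r) =
    B.trans (CB.comm-cong (δ≈φδpre l) (δ≈φδpre r)) (B.sym (comm-homo _ _))

module SignedSum (H : Group 0ℓ 0ℓ) where
  open Group H
  open GroupProperties H using (ε⁻¹≈ε)

  Σ± : ∀ {d} → (Vec Bool d → Carrier) → Carrier
  Σ± {zero}  φ = φ []
  Σ± {suc d} φ = Σ± (λ S → φ (true ∷ S)) ∙ Σ± (λ S → φ (false ∷ S)) ⁻¹

  Σ±-cong : ∀ {d} {φ ψ : Vec Bool d → Carrier} → (∀ S → φ S ≈ ψ S) → Σ± φ ≈ Σ± ψ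
  Σ±-cong {zero}  φ≈ψ = φ≈ψ []
  Σ±-cong {suc d} φ≈ψ =
    ∙-cong (Σ±-cong (λ S → φ≈ψ (true ∷ S))) (⁻¹-cong (Σ±-cong (λ S → φ≈ψ (false ∷ S))))

  Σ±-vanish : ∀ {d} {φ : Vec Bool d → Carrier} → (∀ S → φ S ≈ ε) → Σ± φ ≈ ε
  Σ±-vanish {zero}  φ≈ε = φ≈ε []
  Σ±-vanish {suc d} φ≈ε = trans
    (∙-cong (Σ±-vanish (λ S → φ≈ε (true ∷ S)))
            (trans (⁻¹-cong (Σ±-vanish (λ S → φ≈ε (false ∷ S)))) ε⁻¹≈ε))
    (identityʳ ε)

  Σ±-corner : ∀ {d} {φ : Vec Bool d → Carrier} {h} → φ (corner d) ≈ h →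
    (∀ S → S ≢ corner d → φ S ≈ ε) → Σ± φ ≈ h
  Σ±-corner {zero}  at-corner _        = at-corner
  Σ±-corner {suc d} {h = h} at-corner elsewhere = trans
    (∙-cong (Σ±-corner at-corner (λ S S≢c → elsewhere (true ∷ S) (cons-true S≢c)))
            (trans (⁻¹-cong (Σ±-vanish (λ S → elsewhere (false ∷ S) λ ()))) ε⁻¹≈ε))
    (identityʳ h)
    where
    cons-true : ∀ {S} → S ≢ corner d → true ∷ S ≢ corner (suc d)
    cons-true S≢c e = S≢c (Vec.∷-injectiveʳ e)

module WreathCommutators (H G : Group 0ℓ 0ℓ) where
  open Wreath H G using (Elt; mk)
  open Wreath.Elt
  private
    module H = Group H
    module G = Group G
    module W = Group (H ≀ G)
    module CH = Commutators H
    module CG = Commutators G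
    module CW = Commutators (H ≀ G)
  open SignedSum H

  pos-δ : ∀ {m} (t : Tree Elt m) → pos (CW.δ t) ≡ CG.δ (mapTree pos t)
  pos-δ (leaf x)   = refl
  pos-δ (node l r) = ≡.cong₂ CG.[_,_] (pos-δ l) (pos-δ r)

  fn-comm : ∀ X Y x → let c = CG.[ pos X , pos Y ] in
    fn CW.[ X , Y ] x H.≈
      (fn X x H.∙ fn Y (x G.∙ pos X)) H.∙ (fn Y (x G.∙ c) H.∙ fn X ((x G.∙ c) G.∙ pos Y)) H.⁻¹
  fn-comm X Y x = H.∙-congˡ (H.⁻¹-cong
    (H.∙-cong (cong Y (G.assoc x _ _)) (cong X (G.∙-congʳ (G.assoc x _ _)))))

  comm-base : CH.Law 1 → ∀ X Y → pos X G.≈ G.ε → pos Y G.≈ G.ε → CW.[ X , Y ] W.≈ W.ε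
  comm-base abelian X Y pX≈ε pY≈ε = fn-trivial , c≈ε
    where
    c≈ε : CG.[ pos X , pos Y ] G.≈ G.ε
    c≈ε = G.trans (CG.comm-cong pX≈ε pY≈ε) (CG.comm-self G.ε)
    shift : ∀ {x g} → g G.≈ G.ε → x G.∙ g G.≈ x
    shift {x} g≈ε = G.trans (G.∙-congˡ g≈ε) (G.identityʳ x)
    fn-trivial : ∀ x → fn CW.[ X , Y ] x H.≈ H.ε
    fn-trivial x = begin
      fn CW.[ X , Y ] x
        ≈⟨ fn-comm X Y x ⟩
      _ ≈⟨ H.∙-cong (H.∙-congˡ (cong Y (shift pX≈ε)))
                    (H.⁻¹-cong (H.∙-cong (cong Y (shift c≈ε))
                                         (cong X (G.trans (shift pY≈ε) (shift c≈ε))))) ⟩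
      CH.[ fn X x , fn Y x ]
        ≈⟨ abelian (node (leaf (fn X x)) (leaf (fn Y x))) ⟩
      H.ε ∎
      where open SetoidReasoning H.setoid

  law-wreath : CH.Law 1 → ∀ {m} → CG.Law m → CW.Law (suc m)
  law-wreath abelian law (node l r) = comm-base abelian (CW.δ l) (CW.δ r)
    (G.trans (G.reflexive (pos-δ l)) (law (mapTree pos l)))
    (G.trans (G.reflexive (pos-δ r)) (law (mapTree pos r)))

  ι : G.Carrier → Elt
  ι g = mk (λ _ → H.ε) (λ _ → H.refl) g

  pos-δ-ι : ∀ {m} (s : Tree G.Carrier m) → pos (CW.δ (mapTree ι s)) ≡ CG.δ s
  pos-δ-ι (leaf g)   = refl
  pos-δ-ι (node l r) = ≡.cong₂ CG.[_,_] (pos-δ-ι l) (pos-δ-ι r)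

  fn-δ-ι : ∀ {m} (s : Tree G.Carrier m) x → fn (CW.δ (mapTree ι s)) x H.≈ H.ε
  fn-δ-ι (leaf g)   x = H.refl
  fn-δ-ι (node l r) x = H.trans
    (H.∙-cong (H.∙-cong (fn-δ-ι l x) (fn-δ-ι r _)) (H.⁻¹-cong (H.∙-cong (fn-δ-ι r _) (fn-δ-ι l _))))
    (CH.comm-self H.ε)

  module Perturbation (f : G.Carrier → H.Carrier)
                      (f-cong : ∀ {x y} → x G.≈ y → f x H.≈ f y) where

    perturb : ∀ {m} → Tree G.Carrier m → Tree Elt m
    perturb (leaf g)   = leaf (mk f f-cong g)
    perturb (node l r) = node (mapTree ι l) (perturb r)

    pos-δ-perturb : ∀ {m} (s : Tree G.Carrier m) → pos (CW.δ (perturb s)) G.≈ CG.δ s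
    pos-δ-perturb (leaf g)   = G.refl
    pos-δ-perturb (node l r) = CG.comm-cong (G.reflexive (pos-δ-ι l)) (pos-δ-perturb r)

    pos-spine-perturb : ∀ {m} (s : Tree G.Carrier m) S →
      pos (CW.spine (perturb s) S) G.≈ CG.spine s S
    pos-spine-perturb (leaf g)   []          = G.refl
    pos-spine-perturb (node l r) (true ∷ S)  =
      G.∙-cong (G.reflexive (pos-δ-ι l)) (pos-spine-perturb r S)
    pos-spine-perturb (node l r) (false ∷ S) =
      G.∙-cong (pos-δ-perturb (node l r)) (pos-spine-perturb r S)

    fn-δ-perturb : ∀ {m} (s : Tree G.Carrier m) x →
      fn (CW.δ (perturb s)) x H.≈ Σ± (λ S → f (x G.∙ CG.spine s S))
    fn-δ-perturb (leaf g)   x = f-cong (G.sym (G.identityʳ x))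
    fn-δ-perturb (node l r) x = begin
      fn CW.[ X , Y ] x
        ≈⟨ fn-comm X Y x ⟩
      (fn X x H.∙ fn Y (x G.∙ pos X)) H.∙ (fn Y (x G.∙ c) H.∙ fn X ((x G.∙ c) G.∙ pos Y)) H.⁻¹
        ≈⟨ H.∙-cong (H.∙-congʳ (fn-δ-ι l x))
                    (H.⁻¹-cong (H.∙-congˡ (fn-δ-ι l _))) ⟩
      (H.ε H.∙ fn Y (x G.∙ pos X)) H.∙ (fn Y (x G.∙ c) H.∙ H.ε) H.⁻¹
        ≈⟨ H.∙-cong (H.identityˡ _) (H.⁻¹-cong (H.identityʳ _)) ⟩
      fn Y (x G.∙ pos X) H.∙ fn Y (x G.∙ c) H.⁻¹
        ≈⟨ H.∙-cong (sample (G.reflexive (pos-δ-ι l)))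
                    (H.⁻¹-cong (sample (CG.comm-cong (G.reflexive (pos-δ-ι l)) (pos-δ-perturb r)))) ⟩
      Σ± (λ S → f (x G.∙ CG.spine (node l r) S)) ∎
      where
      open SetoidReasoning H.setoid
      X Y : Elt
      X = CW.δ (mapTree ι l)
      Y = CW.δ (perturb r)
      c : G.Carrier
      c = CG.[ pos X , pos Y ]
      sample : ∀ {z b} → z G.≈ b → fn Y (x G.∙ z) H.≈ Σ± (λ S → f (x G.∙ (b G.∙ CG.spine r S)))
      sample {z} z≈b = H.trans (fn-δ-perturb r (x G.∙ z))
        (Σ±-cong (λ S → f-cong (G.trans (G.assoc x z (CG.spine r S)) (G.∙-congˡ (G.∙-congʳ z≈b)))))

  module SelectorStep (_≟_ : Decidable H._≈_) {h} (h≉ε : ¬ h H.≈ H.ε)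
                      {m} (t : Tree G.Carrier m) (sel : CG.Selector t) where
    open CG.Selector sel

    choose : Bool → H.Carrier
    choose b = if b then h else H.ε

    indicator : G.Carrier → H.Carrier
    indicator x = choose (select x)

    open Perturbation indicator (λ x≈y → H.reflexive (≡.cong choose (select-cong x≈y)))

    T : Tree Elt (suc m)
    T = perturb (node t t)

    w : Elt
    w = CW.δ T

    pos-w : pos w G.≈ G.ε
    pos-w = G.trans (pos-δ-perturb (node t t)) (CG.comm-self (CG.δ t))

    -- The alternating sum sees only the selected spine point.
    fn-w : fn w G.ε H.≈ h
    fn-w = H.trans (fn-δ-perturb (node t t) G.ε)
      (Σ±-corner {φ = λ S → indicator (G.ε G.∙ CG.spine (node t t) S)}
        (value (corner (suc m)) select-corner) (λ S S≢c → value S (select-other S S≢c)))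
      where
      value : ∀ S {b} → select (CG.spine (node t t) S) ≡ b →
        indicator (G.ε G.∙ CG.spine (node t t) S) H.≈ choose b
      value S e = H.reflexive (≡.trans (≡.cong choose (select-cong (G.identityˡ _))) (≡.cong choose e))

    -- The spine points of node T T lie over those of node t t ...
    pos-points : ∀ b S → pos (CW.spine (node T T) (b ∷ S)) G.≈ CG.spine (node t t) S
    pos-points true  S = G.trans (G.∙-cong pos-w (pos-spine-perturb (node t t) S)) (G.identityˡ _)
    pos-points false S =
      G.trans (G.∙-cong (CG.comm-self (pos w)) (pos-spine-perturb (node t t) S)) (G.identityˡ _)

    -- ... and over the selected one, the two of them differ by h at ε.
    y₀ : H.Carrier
    y₀ = fn (CW.spine T (corner (suc m))) G.ε

    fn-corner : fn (CW.spine (node T T) (corner (suc (suc m)))) G.ε H.≈ h H.∙ y₀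
    fn-corner = H.∙-cong fn-w (cong (CW.spine T (corner (suc m))) (G.trans (G.identityˡ _) pos-w))

    fn-opposite : fn (CW.spine (node T T) (false ∷ corner (suc m))) G.ε H.≈ y₀
    fn-opposite = H.trans
      (H.∙-cong (proj₁ (CW.comm-self w) G.ε)
                (cong (CW.spine T (corner (suc m))) (G.trans (G.identityˡ _) (proj₂ (CW.comm-self w)))))
      (H.identityˡ y₀)

    -- The new selector: lie over the old selected point and take the value h y₀ at ε.
    select' : Elt → Bool
    select' z = select (pos z) ∧ does (fn z G.ε ≟ (h H.∙ y₀))

    selector : CW.Selector T
    selector = record
      { select        = select'
      ; select-cong   = λ (fn≈ , pos≈) →
          ≡.cong₂ _∧_ (select-cong pos≈) (does-resp H _≟_ (fn≈ G.ε))
      ; select-corner = ≡.cong₂ _∧_ (selected true)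
          (dec-true (fn (CW.spine (node T T) (corner (suc (suc m)))) G.ε ≟ (h H.∙ y₀)) fn-corner)
      ; select-other  = other
      }
      where
      selected : ∀ b → select (pos (CW.spine (node T T) (b ∷ corner (suc m)))) ≡ true
      selected b = ≡.trans (select-cong (pos-points b (corner (suc m)))) select-corner

      y₀≉hy₀ : ¬ y₀ H.≈ h H.∙ y₀
      y₀≉hy₀ e = h≉ε (GroupProperties.identityˡ-unique H h y₀ (H.sym e))

      rejected-by-pos : ∀ z → select (pos z) ≡ false → select' z ≡ false
      rejected-by-pos z e = ≡.cong (_∧ does (fn z G.ε ≟ (h H.∙ y₀))) e

      rejected-by-fn : ∀ z → ¬ fn z G.ε H.≈ h H.∙ y₀ → select' z ≡ false
      rejected-by-fn z ≉ = ≡.trans (≡.cong (select (pos z) ∧_) (dec-false (fn z G.ε ≟ (h H.∙ y₀)) ≉))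
                                   (Bool.∧-zeroʳ _)

      other : ∀ S → S ≢ corner (suc (suc m)) → select' (CW.spine (node T T) S) ≡ false
      other (b ∷ S) S≢c with Vec.≡-dec Bool._≟_ S (corner (suc m))
      ... | no S≢c' = rejected-by-pos (CW.spine (node T T) (b ∷ S))
        (≡.trans (select-cong (pos-points b S)) (select-other S S≢c'))
      other (true ∷ S)  S≢c | yes refl = ⊥-elim (S≢c refl)
      other (false ∷ S) S≢c | yes refl = rejected-by-fn (CW.spine (node T T) (false ∷ S))
        λ e → y₀≉hy₀ (H.trans (H.sym fn-opposite) e)

cyclic-≟ : ∀ n → Decidable (Group._≈_ (Cyclic n))
cyclic-≟ n x y = (+ n) ∣? (x - y)

cyclic-law₁ : ∀ n → Commutators.Law (Cyclic n) 1
cyclic-law₁ n = Commutators.abelian⇒law₁ (Cyclic n) (λ x y → Group.reflexive (Cyclic n) (ℤ.+-comm x y))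

cyclic-1≉0 : ∀ {n} → 2 ≤ n → ¬ Group._≈_ (Cyclic n) (+ 1) (+ 0)
cyclic-1≉0 (s≤s (s≤s _)) n∣1 with () ← ℕ∣.∣1⇒≡1 (∣⇒∣ᵤ n∣1)

iterated-law : ∀ j (ms : Vec ℕ (suc j)) → Commutators.Law (IterWreath ms) (suc j)
iterated-law zero    (m ∷ [])      = cyclic-law₁ m
iterated-law (suc j) (m ∷ m' ∷ ms) =
  WreathCommutators.law-wreath (Cyclic m) (IterWreath (m' ∷ ms)) (cyclic-law₁ m)
    (iterated-law j (m' ∷ ms))

iterated-selector : ∀ k (ns : Vec ℕ (suc k)) → All (2 ≤_) ns →
  Σ (Tree (Group.Carrier (IterWreath ns)) k) (Commutators.Selector (IterWreath ns))
iterated-selector zero (n ∷ []) (2≤n All.∷ All.[]) =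
  leaf (+ 1) , Commutators.leaf-selector (Cyclic n) (cyclic-≟ n) {+ 1} (cyclic-1≉0 2≤n)
iterated-selector (suc k) (n ∷ m ∷ ms) (2≤n All.∷ 2≤ms) =
  Step.T , Step.selector
  where
  below : Σ (Tree (Group.Carrier (IterWreath (m ∷ ms))) k) (Commutators.Selector (IterWreath (m ∷ ms)))
  below = iterated-selector k (m ∷ ms) 2≤ms
  module Step = WreathCommutators.SelectorStep (Cyclic n) (IterWreath (m ∷ ms))
    (cyclic-≟ n) {+ 1} (cyclic-1≉0 2≤n) (proj₁ below) (proj₂ below)

proposition3p3 : (k : ℕ) (ns : Vec ℕ (suc k)) → All (2 ≤_) ns →
    WreathLengthIs (IterWreath ns) (suc k)
proposition3p3 k ns 2≤ns = (ns , All.map (≤-trans (n≤1+n 1)) 2≤ns , identity) , no-shorter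
  where
  K = IterWreath ns
  identity : Epimorphism K K
  identity = (λ x → x) , Identity.isGroupHomomorphism (Group.rawGroup K) (Group.refl K) ,
             (λ y → y , λ y≈ → y≈)
  witness : Σ (Tree (Group.Carrier K) k) (Commutators.Selector K)
  witness = iterated-selector k ns 2≤ns
  -- An image of a (j+1)-fold wreath product satisfies the depth-(j+1) law,
  -- hence the depth-k law, contradicting the selector's nontrivial commutator.
  no-shorter : ∀ j → j < k → ¬ ImageOfCyclicWreath j K
  no-shorter j j<k (ms , _ , epi) =
    Commutators.selector⇒nontrivial K (proj₂ witness)
      (Commutators.law-mono K (≤⇒≤′ j<k) (law-image epi (iterated-law j ms)) (proj₁ witness))
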